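{- Let $n\ge1$ be a natural number and let $D$ be an infinite division ring satisfying $(\dagger)_n$. Then any strictly descending chain of definable infinite subfields of $D$ has length at most $\lfloor\log_2(n)\rfloor+1$. Consequently, if $\mathcal F$ is a family of definable subfields of $D$, then the intersection of all subfields in $\mathcal F$ equals the intersection of finitely many members of $\mathcal F$, and hence is definable.
   Context: A division ring $D$ satisfies $(\dagger)_n$ if for any definable (in the structure $(D,+,\cdot)$) subgroups $H_0,\dots,H_n$ of $(D,+)$ there exists $j\le n$ such that $\bigcap_{i\le n}H_i$ has finite index in $\bigcap_{i\neq j}H_i$. -}

module Defs where

open import Level using (Level; _⊔_; suc)
open import Algebra.Bundles using (Ring)
open import Data.Nat using (ℕ; zero) renaming (suc to sucℕ)
open import Data.Fin using (Fin; _<_) renaming (zero to fzero; suc to fsuc)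
open import Data.Product using (Σ; _×_; _,_; ∃)
open import Data.Sum using (_⊎_)
open import Data.Empty using (⊥)
open import Data.Unit.Polymorphic using (⊤)
open import Relation.Nullary using (¬_)
open import Relation.Binary.PropositionalEquality using (_≢_)
open import Function.Bundles using (_⇔_)

record DivisionRing (c ℓ : Level) : Set (suc (c ⊔ ℓ)) where
  field
    ring : Ring c ℓ
  open Ring ring public
  field
    1≉0     : ¬ (1# ≈ 0#)
    inverse : ∀ x → ¬ (x ≈ 0#) → Σ Carrier λ y → (x * y ≈ 1#) × (y * x ≈ 1#)

data Term (k : ℕ) : Set where
  var  : Fin k → Term k
  _⊕_  : Term k → Term k → Term k
  _⊗_  : Term k → Term k → Term k

data Formula : ℕ → Set where
  _≐_  : ∀ {k} → Term k → Term k → Formula k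
  falsum : ∀ {k} → Formula k
  ¬'_  : ∀ {k} → Formula k → Formula k
  _∧'_ : ∀ {k} → Formula k → Formula k → Formula k
  _∨'_ : ∀ {k} → Formula k → Formula k → Formula k
  _⇒'_ : ∀ {k} → Formula k → Formula k → Formula k
  ∀'_  : ∀ {k} → Formula (sucℕ k) → Formula k   -- binds variable fzero
  ∃'_  : ∀ {k} → Formula (sucℕ k) → Formula k   -- binds variable fzero

_∷ₐ_ : ∀ {a} {A : Set a} {k} → A → (Fin k → A) → Fin (sucℕ k) → A
(x ∷ₐ ρ) fzero    = x
(x ∷ₐ ρ) (fsuc i) = ρ i

module Semantics {c ℓ : Level} (D : DivisionRing c ℓ) where
  open DivisionRing D

  ⟦_⟧ₜ : ∀ {k} → Term k → (Fin k → Carrier) → Carrier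
  ⟦ var i ⟧ₜ ρ = ρ i
  ⟦ s ⊕ t ⟧ₜ ρ = ⟦ s ⟧ₜ ρ + ⟦ t ⟧ₜ ρ
  ⟦ s ⊗ t ⟧ₜ ρ = ⟦ s ⟧ₜ ρ * ⟦ t ⟧ₜ ρ

  Sat : ∀ {k} → Formula k → (Fin k → Carrier) → Set (c ⊔ ℓ)
  Sat (s ≐ t) ρ  = Level.Lift c (⟦ s ⟧ₜ ρ ≈ ⟦ t ⟧ₜ ρ)
  Sat falsum ρ   = ⊥'
    where ⊥' = Level.Lift (c ⊔ ℓ) ⊥
  Sat (¬' φ) ρ   = ¬ Sat φ ρ
  Sat (φ ∧' ψ) ρ = Sat φ ρ × Sat ψ ρ
  Sat (φ ∨' ψ) ρ = Sat φ ρ ⊎ Sat ψ ρ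
  Sat (φ ⇒' ψ) ρ = Sat φ ρ → Sat ψ ρ
  Sat (∀' φ) ρ   = ∀ x → Sat φ (x ∷ₐ ρ)
  Sat (∃' φ) ρ   = Σ Carrier λ x → Sat φ (x ∷ₐ ρ)

  Subset : Set (suc (c ⊔ ℓ))
  Subset = Carrier → Set (c ⊔ ℓ)

  Definable : Subset → Set (c ⊔ ℓ)
  Definable P = Σ ℕ λ m → Σ (Formula (sucℕ m)) λ φ → Σ (Fin m → Carrier) λ b →
                  ∀ x → P x ⇔ Sat φ (x ∷ₐ b)

  FiniteSubset : Subset → Set (c ⊔ ℓ)
  FiniteSubset P = Σ ℕ λ k → Σ (Fin k → Carrier) λ r →
                     ∀ x → P x → Σ (Fin k) λ i → x ≈ r i

  InfiniteSubset : Subset → Set (c ⊔ ℓ)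
  InfiniteSubset P = ¬ FiniteSubset P

  Infinite : Set (c ⊔ ℓ)
  Infinite = InfiniteSubset (λ _ → ⊤)

  record IsAddSubgroup (H : Subset) : Set (c ⊔ ℓ) where
    field
      resp  : ∀ {x y} → x ≈ y → H x → H y
      0∈    : H 0#
      +-closed : ∀ {x y} → H x → H y → H (x + y)
      neg-closed : ∀ {x} → H x → H (- x)

  FiniteIndexIn : Subset → Subset → Set (c ⊔ ℓ)
  FiniteIndexIn A B = Σ ℕ λ k → Σ (Fin k → Carrier) λ r →
                        (∀ i → B (r i)) ×
                        (∀ x → B x → Σ (Fin k) λ i → A (x - r i))

  ⋂ : ∀ {n} → (Fin n → Subset) → Subset
  ⋂ H x = ∀ i → H i x

  ⋂-without : ∀ {n} → (Fin n → Subset) → Fin n → Subset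
  ⋂-without H j x = ∀ i → i ≢ j → H i x

  Dagger : ℕ → Set (suc (c ⊔ ℓ))
  Dagger n = (H : Fin (sucℕ n) → Subset) →
             (∀ i → Definable (H i)) → (∀ i → IsAddSubgroup (H i)) →
             Σ (Fin (sucℕ n)) λ j → FiniteIndexIn (⋂ H) (⋂-without H j)

  record IsSubfield (K : Subset) : Set (c ⊔ ℓ) where
    field
      resp       : ∀ {x y} → x ≈ y → K x → K y
      0∈         : K 0#
      1∈         : K 1#
      +-closed   : ∀ {x y} → K x → K y → K (x + y)
      neg-closed : ∀ {x} → K x → K (- x)
      *-closed   : ∀ {x y} → K x → K y → K (x * y)
      inv-closed : ∀ {x} → K x → ¬ (x ≈ 0#) → Σ Carrier λ y → K y × (x * y ≈ 1#)
      comm       : ∀ {x y} → K x → K y → x * y ≈ y * x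

  _⊂_ : Subset → Subset → Set (c ⊔ ℓ)
  L ⊂ K = (∀ x → L x → K x) × Σ Carrier λ x → K x × ¬ L x

  StrictlyDescending : ∀ {m} → (Fin m → Subset) → Set (c ⊔ ℓ)
  StrictlyDescending F = ∀ i j → i < j → F j ⊂ F i

-- Let F₀ ⊋ F₁ ⊋ … ⊋ Fₖ = L be subfields with L definable and infinite, and
-- pick bᵢ ∈ Fᵢ₋₁ ∖ Fᵢ.  Since 1 and bᵢ are linearly independent over Fᵢ,
-- induction on k yields 2^k definable additive subgroups Hₛ and elements eₛ
-- such that for l ∈ L the element l·eₛ lies in every Hₜ with t ≠ s, but lies
-- in Hₛ only when l = 0: from a family (W, Hₛ, eₛ) for the chain below F₀
-- one passes to W + W·b, with the subgroups Hₛ + W·b, W + Hₛ·b and the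
-- elements eₛ, eₛ·b.  If 2^k > n, (†)ₙ applied to n + 1 of these subgroups
-- gives a j such that ⋂ Hₜ has finite index in ⋂_{t ≠ j} Hₜ; l ↦ l·eⱼ maps
-- L into the latter and distinct elements of L land in distinct cosets, so L
-- is finite.  Hence 2^k ≤ n, which bounds the length of the chain.
--
-- For an arbitrary family of definable subfields, if no finite subfamily had
-- the same intersection, one could choose a strictly descending sequence of
-- finite intersections, all of them definable subfields.  None of them is
-- finite (a finite set has no infinite strictly descending sequence of
-- subsets), so its first ⌊log₂ n⌋ + 2 members contradict the bound.

module Submission where

open import Defs
open import Level using (Level; Lift; lift; lower; _⊔_)
open import Axiom.ExcludedMiddle using (ExcludedMiddle)
import Data.Nat as ℕ
open import Data.Nat using (ℕ; zero; suc; _≤_; _^_; z≤n; s≤s; _≤′_; ≤′-step; ≤′-refl)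
import Data.Nat.Properties as ℕₚ
open import Data.Nat.Properties using (<⇒≤; ≮⇒≥; n≮n; n<1+n; ≤⇒≤′)
open import Data.Nat.Logarithm using (⌊log₂_⌋; ⌊log₂⌋-mono-≤; ⌊log₂[2^n]⌋≡n)
open import Data.Fin using (Fin; fromℕ; toℕ; inject≤; _↑ˡ_; _↑ʳ_) renaming (zero to fzero; suc to fsuc)
open import Data.Fin.Properties using (inject≤-injective; *↔×; pigeonhole)
open import Data.Vec.Functional using (_++_)
open import Data.Vec.Functional.Properties using (lookup-++ˡ; lookup-++ʳ)
open import Data.Product using (Σ; _×_; _,_; proj₁; proj₂)
open import Data.Product.Function.NonDependent.Propositional using (_×-⇔_)
open import Data.Sum.Function.Propositional using (_⊎-⇔_)
open import Data.Empty using (⊥-elim)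
open import Relation.Nullary using (¬_; yes; no)
open import Relation.Nullary.Decidable using (decidable-stable)
open import Relation.Binary.PropositionalEquality as ≡ using (_≡_; _≢_)
open import Function using (_∘_; id)
open import Function.Bundles using (_⇔_; mk⇔; Equivalence; _↣_; mk↣; Injection)
open import Function.Properties.Inverse using (↔⇒↣)
open import Function.Related.TypeIsomorphisms using (→-cong-⇔; ¬-cong-⇔)
import Function.Properties.Equivalence as ⇔

ext : ∀ {k k'} → (Fin k → Fin k') → Fin (suc k) → Fin (suc k')
ext f = fzero ∷ₐ (fsuc ∘ f)

renameₜ : ∀ {k k'} → (Fin k → Fin k') → Term k → Term k'
renameₜ f (var i) = var (f i)
renameₜ f (s ⊕ t) = renameₜ f s ⊕ renameₜ f t
renameₜ f (s ⊗ t) = renameₜ f s ⊗ renameₜ f t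

rename : ∀ {k k'} → (Fin k → Fin k') → Formula k → Formula k'
rename f (s ≐ t) = renameₜ f s ≐ renameₜ f t
rename f falsum = falsum
rename f (¬' φ) = ¬' rename f φ
rename f (φ ∧' ψ) = rename f φ ∧' rename f ψ
rename f (φ ∨' ψ) = rename f φ ∨' rename f ψ
rename f (φ ⇒' ψ) = rename f φ ⇒' rename f ψ
rename f (∀' φ) = ∀' rename (ext f) φ
rename f (∃' φ) = ∃' rename (ext f) φ

2^k≤n⇒k≤⌊log₂n⌋ : ∀ {k n} → 2 ^ k ≤ n → k ≤ ⌊log₂ n ⌋
2^k≤n⇒k≤⌊log₂n⌋ {k} 2^k≤n = ≡.subst (_≤ _) (⌊log₂[2^n]⌋≡n k) (⌊log₂⌋-mono-≤ 2^k≤n)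

module _ {c ℓ : Level} (D : DivisionRing c ℓ) where
  open DivisionRing D
  open Semantics D
  open import Algebra.Properties.Ring ring
    using (-0#≈0#; ⁻¹-anti-homo‿-; [y-z]x≈yx-zx; \\-leftDividesʳ; //-rightDividesʳ; x∙y⁻¹≈ε⇒x≈y; +-cancelʳ; -‿+-comm; -‿distribˡ-*)
  open import Algebra.Properties.CommutativeSemigroup +-commutativeSemigroup using (interchange)
  open import Relation.Binary.Reasoning.Setoid setoid
  open Equivalence using (to; from)

  -- Definable sets

  ⟦renameₜ⟧ : ∀ {k k'} (t : Term k) {f : Fin k → Fin k'} {ρ : Fin k → Carrier} {ρ' : Fin k' → Carrier} →
              (∀ i → ρ' (f i) ≡ ρ i) → ⟦ renameₜ f t ⟧ₜ ρ' ≡ ⟦ t ⟧ₜ ρ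
  ⟦renameₜ⟧ (var i) h = h i
  ⟦renameₜ⟧ (s ⊕ t) h = ≡.cong₂ _+_ (⟦renameₜ⟧ s h) (⟦renameₜ⟧ t h)
  ⟦renameₜ⟧ (s ⊗ t) h = ≡.cong₂ _*_ (⟦renameₜ⟧ s h) (⟦renameₜ⟧ t h)

  ext-agrees : ∀ {k k'} {f : Fin k → Fin k'} {ρ : Fin k → Carrier} {ρ' : Fin k' → Carrier} → (∀ i → ρ' (f i) ≡ ρ i) →
               ∀ x i → (x ∷ₐ ρ') (ext f i) ≡ (x ∷ₐ ρ) i
  ext-agrees h x fzero = ≡.refl
  ext-agrees h x (fsuc i) = h i

  Sat-rename : ∀ {k k'} (φ : Formula k) {f : Fin k → Fin k'} {ρ : Fin k → Carrier} {ρ' : Fin k' → Carrier} →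
               (∀ i → ρ' (f i) ≡ ρ i) → Sat φ ρ ⇔ Sat (rename f φ) ρ'
  Sat-rename (s ≐ t) h =
    mk⇔ (λ (lift e) → lift (≡.subst₂ _≈_ (≡.sym (⟦renameₜ⟧ s h)) (≡.sym (⟦renameₜ⟧ t h)) e))
        (λ (lift e) → lift (≡.subst₂ _≈_ (⟦renameₜ⟧ s h) (⟦renameₜ⟧ t h) e))
  Sat-rename falsum h = ⇔.refl
  Sat-rename (¬' φ) h = ¬-cong-⇔ (Sat-rename φ h)
  Sat-rename (φ ∧' ψ) h = Sat-rename φ h ×-⇔ Sat-rename ψ h
  Sat-rename (φ ∨' ψ) h = Sat-rename φ h ⊎-⇔ Sat-rename ψ h
  Sat-rename (φ ⇒' ψ) h = →-cong-⇔ (Sat-rename φ h) (Sat-rename ψ h)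
  Sat-rename (∀' φ) h = mk⇔ (λ p x → to (Sat-rename φ (ext-agrees h x)) (p x))
                            (λ p x → from (Sat-rename φ (ext-agrees h x)) (p x))
  Sat-rename (∃' φ) h = mk⇔ (λ (x , p) → x , to (Sat-rename φ (ext-agrees h x)) p)
                            (λ (x , p) → x , from (Sat-rename φ (ext-agrees h x)) p)

  Sat-substitute : ∀ {k m} (φ : Formula (suc m)) {b : Fin m → Carrier} {ρ : Fin k → Carrier} v {g : Fin m → Fin k} →
                   (∀ i → ρ (g i) ≡ b i) → Sat φ (ρ v ∷ₐ b) ⇔ Sat (rename (v ∷ₐ g) φ) ρ
  Sat-substitute φ v h = Sat-rename φ λ { fzero → ≡.refl ; (fsuc i) → h i }

  Definable-resp : ∀ {P Q} → Definable P → (∀ x → P x ⇔ Q x) → Definable Q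
  Definable-resp (m , φ , b , P⇔φ) P⇔Q = m , φ , b , λ x → ⇔.trans (⇔.sym (P⇔Q x)) (P⇔φ x)

  Definable-∩ : ∀ {P Q} → Definable P → Definable Q → Definable (λ x → P x × Q x)
  Definable-∩ (mP , φP , bP , P⇔φP) (mQ , φQ , bQ , Q⇔φQ) =
    mP ℕ.+ mQ , rename (fzero ∷ₐ (fsuc ∘ (_↑ˡ mQ))) φP ∧' rename (fzero ∷ₐ (fsuc ∘ (mP ↑ʳ_))) φQ , bP ++ bQ ,
    λ x → ⇔.trans (P⇔φP x) (Sat-substitute φP fzero (lookup-++ˡ bP bQ))
       ×-⇔ ⇔.trans (Q⇔φQ x) (Sat-substitute φQ fzero (lookup-++ʳ bP bQ))

  Definable-⋂ : ∀ {k} (H : Fin k → Subset) → (∀ i → Definable (H i)) → Definable (⋂ H)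
  Definable-⋂ {zero} H _ = 0 , var fzero ≐ var fzero , (λ ()) , λ x → mk⇔ (λ _ → lift refl) (λ _ ())
  Definable-⋂ {suc k} H dH = Definable-resp (Definable-∩ (dH fzero) (Definable-⋂ (H ∘ fsuc) (dH ∘ fsuc)))
    λ x → mk⇔ (λ (h₀ , h) → λ { fzero → h₀ ; (fsuc i) → h i }) (λ h → h fzero , h ∘ fsuc)

  ｛0｝ : Subset
  ｛0｝ x = Lift c (x ≈ 0#)

  Definable-｛0｝ : Definable ｛0｝
  Definable-｛0｝ = 1 , var fzero ≐ var (fsuc fzero) , (λ _ → 0#) , λ x → ⇔.refl

  _⊞_·_ : Subset → Subset → Carrier → Subset
  (P ⊞ Q · b) x = Σ Carrier λ y → Σ Carrier λ z → P y × Q z × x ≈ y + z * b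

  Definable-⊞ : ∀ {P Q} → Definable P → Definable Q → ∀ b → Definable (P ⊞ Q · b)
  Definable-⊞ {P} {Q} (mP , φP , bP , P⇔φP) (mQ , φQ , bQ , Q⇔φQ) b = m , φ , params , λ x →
    mk⇔ (λ (y , z , p , q , e) → y , z , to (P⇔ x y z) p , to (Q⇔ x y z) q , to (≈⇔ x y z) e)
        (λ (y , z , p , q , e) → y , z , from (P⇔ x y z) p , from (Q⇔ x y z) q , from (≈⇔ x y z) e)
    where
    m : ℕ
    m = mP ℕ.+ (mQ ℕ.+ 1)
    params : Fin m → Carrier
    params = bP ++ (bQ ++ λ _ → b)
    -- φ is ∃y ∃z. φP(y) ∧ φQ(z) ∧ x = y + z·b; its body sees the variables z, y, x, params
    env : Carrier → Carrier → Carrier → Fin (3 ℕ.+ m) → Carrier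
    env x y z = z ∷ₐ (y ∷ₐ (x ∷ₐ params))
    param : Fin m → Fin (3 ℕ.+ m)
    param = fsuc ∘ fsuc ∘ fsuc
    β : Fin m
    β = mP ↑ʳ (mQ ↑ʳ fzero)
    φP′ : Formula (3 ℕ.+ m)
    φP′ = rename (fsuc fzero ∷ₐ (param ∘ (_↑ˡ (mQ ℕ.+ 1)))) φP
    φQ′ : Formula (3 ℕ.+ m)
    φQ′ = rename (fzero ∷ₐ (param ∘ (mP ↑ʳ_) ∘ (_↑ˡ 1))) φQ
    φ : Formula (suc m)
    φ = ∃' ∃' (φP′ ∧' (φQ′ ∧' (var (fsuc (fsuc fzero)) ≐ (var (fsuc fzero) ⊕ (var fzero ⊗ var (param β))))))
    P⇔ : ∀ x y z → P y ⇔ Sat φP′ (env x y z)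
    P⇔ x y z = ⇔.trans (P⇔φP y) (Sat-substitute φP (fsuc fzero) (lookup-++ˡ bP _))
    Q⇔ : ∀ x y z → Q z ⇔ Sat φQ′ (env x y z)
    Q⇔ x y z = ⇔.trans (Q⇔φQ z) (Sat-substitute φQ fzero
                 λ i → ≡.trans (lookup-++ʳ bP _ (i ↑ˡ 1)) (lookup-++ˡ bQ _ i))
    params-β : params β ≡ b
    params-β = ≡.trans (lookup-++ʳ bP _ _) (lookup-++ʳ bQ _ fzero)
    ≈⇔ : ∀ x y z → (x ≈ y + z * b) ⇔ Lift c (x ≈ y + z * params β)
    ≈⇔ x y z rewrite params-β = mk⇔ lift lower

  -- Additive subgroups and subfields

  _⊆_ : Subset → Subset → Set (c ⊔ ℓ)
  P ⊆ Q = ∀ x → P x → Q x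

  IsSubfield⇒IsAddSubgroup : ∀ {K} → IsSubfield K → IsAddSubgroup K
  IsSubfield⇒IsAddSubgroup sK = record { resp = resp ; 0∈ = 0∈ ; +-closed = +-closed ; neg-closed = neg-closed }
    where open IsSubfield sK

  -‿closed : ∀ {H x y} → IsAddSubgroup H → H x → H y → H (x - y)
  -‿closed sH Hx Hy = +-closed Hx (neg-closed Hy)
    where open IsAddSubgroup sH

  [x-r]-[y-r]≈x-y : ∀ x y r → (x - r) - (y - r) ≈ x - y
  [x-r]-[y-r]≈x-y x y r = begin
    (x - r) - (y - r)   ≈⟨ +-congˡ (⁻¹-anti-homo‿- y r) ⟩
    (x - r) + (r - y)   ≈⟨ +-assoc x (- r) (r - y) ⟩
    x + (- r + (r - y)) ≈⟨ +-congˡ (\\-leftDividesʳ r (- y)) ⟩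
    x - y               ∎

  same-coset⇒-‿∈ : ∀ {H x y r} → IsAddSubgroup H → H (x - r) → H (y - r) → H (x - y)
  same-coset⇒-‿∈ {x = x} {y} {r} sH Hx-r Hy-r = IsAddSubgroup.resp sH ([x-r]-[y-r]≈x-y x y r) (-‿closed sH Hx-r Hy-r)

  IsAddSubgroup-｛0｝ : IsAddSubgroup ｛0｝
  IsAddSubgroup-｛0｝ = record
    { resp       = λ x≈y (lift x≈0) → lift (trans (sym x≈y) x≈0)
    ; 0∈         = lift refl
    ; +-closed   = λ (lift x≈0) (lift y≈0) → lift (trans (+-cong x≈0 y≈0) (+-identityʳ 0#))
    ; neg-closed = λ (lift x≈0) → lift (trans (-‿cong x≈0) -0#≈0#)
    }

  x≈x+0*b : ∀ x b → x ≈ x + 0# * b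
  x≈x+0*b x b = begin
    x          ≈⟨ +-identityʳ x ⟨
    x + 0#     ≈⟨ +-congˡ (zeroˡ b) ⟨
    x + 0# * b ∎

  IsAddSubgroup-⊞ : ∀ {P Q} → IsAddSubgroup P → IsAddSubgroup Q → ∀ b → IsAddSubgroup (P ⊞ Q · b)
  IsAddSubgroup-⊞ sP sQ b = record
    { resp       = λ x≈x' (y , z , p , q , x≈) → y , z , p , q , trans (sym x≈x') x≈
    ; 0∈         = 0# , 0# , P.0∈ , Q.0∈ , x≈x+0*b 0# b
    ; +-closed   = λ (y , z , p , q , x≈) (y' , z' , p' , q' , x'≈) →
                     y + y' , z + z' , P.+-closed p p' , Q.+-closed q q' ,
                     trans (+-cong x≈ x'≈) (trans (interchange y (z * b) y' (z' * b)) (+-congˡ (sym (distribʳ b z z'))))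
    ; neg-closed = λ (y , z , p , q , x≈) →
                     - y , - z , P.neg-closed p , Q.neg-closed q ,
                     trans (-‿cong x≈) (trans (sym (-‿+-comm y (z * b))) (+-congˡ (-‿distribˡ-* z b)))
    }
    where module P = IsAddSubgroup sP
          module Q = IsAddSubgroup sQ

  ⊞-mono : ∀ {P P' Q Q'} b → P ⊆ P' → Q ⊆ Q' → (P ⊞ Q · b) ⊆ (P' ⊞ Q' · b)
  ⊞-mono b P⊆P' Q⊆Q' x (y , z , p , q , x≈) = y , z , P⊆P' y p , Q⊆Q' z q , x≈

  ⊞-⊆ : ∀ {P Q K b} → IsSubfield K → K b → P ⊆ K → Q ⊆ K → (P ⊞ Q · b) ⊆ K
  ⊞-⊆ sK Kb P⊆K Q⊆K x (y , z , p , q , x≈) = resp (sym x≈) (+-closed (P⊆K y p) (*-closed (Q⊆K z q) Kb))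
    where open IsSubfield sK

  ⊞-introˡ : ∀ {P Q} b → IsAddSubgroup Q → P ⊆ (P ⊞ Q · b)
  ⊞-introˡ b sQ y p = y , 0# , p , IsAddSubgroup.0∈ sQ , x≈x+0*b y b

  ⊞-introʳ : ∀ {P Q z} b → IsAddSubgroup P → Q z → (P ⊞ Q · b) (z * b)
  ⊞-introʳ {z = z} b sP q = 0# , z , IsAddSubgroup.0∈ sP , q , sym (+-identityˡ (z * b))

  ⊞-intro-* : ∀ {P Q l x} b → IsAddSubgroup P → IsAddSubgroup Q → Q (l * x) → (P ⊞ Q · b) (l * (x * b))
  ⊞-intro-* {l = l} {x} b sP sQ Qlx = IsAddSubgroup.resp (IsAddSubgroup-⊞ sP sQ b) (*-assoc l x b) (⊞-introʳ b sP Qlx)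

  y*[x*b]≈b : ∀ {x y} b → y * x ≈ 1# → y * (x * b) ≈ b
  y*[x*b]≈b {x} {y} b yx≈1 = begin
    y * (x * b) ≈⟨ *-assoc y x b ⟨
    (y * x) * b ≈⟨ *-congʳ yx≈1 ⟩
    1# * b      ≈⟨ *-identityˡ b ⟩
    b           ∎

  left-inverse≈right-inverse : ∀ {x y z} → z * x ≈ 1# → x * y ≈ 1# → z ≈ y
  left-inverse≈right-inverse {x} {y} {z} zx≈1 xy≈1 = begin
    z           ≈⟨ *-identityʳ z ⟨
    z * 1#      ≈⟨ *-congˡ xy≈1 ⟨
    z * (x * y) ≈⟨ *-assoc z x y ⟨
    (z * x) * y ≈⟨ *-congʳ zx≈1 ⟩
    1# * y      ≈⟨ *-identityˡ y ⟩
    y           ∎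

  IsSubfield-⋂ : ∀ {k} (H : Fin (suc k) → Subset) → (∀ i → IsSubfield (H i)) → IsSubfield (⋂ H)
  IsSubfield-⋂ H sH = record
    { resp       = λ x≈y h i → resp (sH i) x≈y (h i)
    ; 0∈         = λ i → 0∈ (sH i)
    ; 1∈         = λ i → 1∈ (sH i)
    ; +-closed   = λ h h' i → +-closed (sH i) (h i) (h' i)
    ; neg-closed = λ h i → neg-closed (sH i) (h i)
    ; *-closed   = λ h h' i → *-closed (sH i) (h i) (h' i)
    ; inv-closed = ⋂-inverse
    ; comm       = λ h h' → comm (sH fzero) (h fzero) (h' fzero)
    }
    where
    open IsSubfield
    ⋂-inverse : ∀ {x} → ⋂ H x → ¬ x ≈ 0# → Σ Carrier λ y → ⋂ H y × x * y ≈ 1#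
    ⋂-inverse {x} h x≉0 with inverse x x≉0
    ... | y , xy≈1 , yx≈1 = y , (λ i → let (yᵢ , Hyᵢ , xyᵢ≈1) = inv-closed (sH i) (h i) x≉0 in
                                        resp (sH i) (sym (left-inverse≈right-inverse yx≈1 xyᵢ≈1)) Hyᵢ) , xy≈1

  -- Strictly descending sequences of subsets

  module _ {S : ℕ → Subset} (S-⊂ : ∀ q → S (suc q) ⊂ S q) where

    ⊂-sequence-antitone : ∀ {p q} → p ≤′ q → S q ⊆ S p
    ⊂-sequence-antitone ≤′-refl = λ _ → id
    ⊂-sequence-antitone (≤′-step p≤q) = λ x → ⊂-sequence-antitone p≤q x ∘ proj₁ (S-⊂ _) x

    ⊂-sequence⇒StrictlyDescending : ∀ {m} → StrictlyDescending (λ (t : Fin m) → S (toℕ t))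
    ⊂-sequence⇒StrictlyDescending i j i<j with S-⊂ (toℕ i)
    ... | _ , x , Six , x∉Si+1 = ⊂-sequence-antitone (≤⇒≤′ (<⇒≤ i<j)) , x , Six ,
                                  x∉Si+1 ∘ ⊂-sequence-antitone (≤⇒≤′ i<j) x

    ⊂-sequence⇒infinite : (∀ q {x y} → x ≈ y → S q x → S q y) → InfiniteSubset (S 0)
    ⊂-sequence⇒infinite S-resp (k , r , covers) =
      let (i , j , i<j , same-index) = pigeonhole (n<1+n k) (proj₁ ∘ cover) in
      dropped∉ (toℕ i) (S-resp (suc (toℕ i)) (dropped-≈ i j same-index)
                          (⊂-sequence-antitone (≤⇒≤′ i<j) _ (dropped∈ (toℕ j))))
      where
      dropped : ℕ → Carrier
      dropped q = proj₁ (proj₂ (S-⊂ q))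
      dropped∈ : ∀ q → S q (dropped q)
      dropped∈ q = proj₁ (proj₂ (proj₂ (S-⊂ q)))
      dropped∉ : ∀ q → ¬ S (suc q) (dropped q)
      dropped∉ q = proj₂ (proj₂ (proj₂ (S-⊂ q)))
      cover : ∀ (t : Fin (suc k)) → Σ (Fin k) λ u → dropped (toℕ t) ≈ r u
      cover t = covers _ (⊂-sequence-antitone (≤⇒≤′ z≤n) _ (dropped∈ (toℕ t)))
      dropped-≈ : ∀ i j → proj₁ (cover i) ≡ proj₁ (cover j) → dropped (toℕ j) ≈ dropped (toℕ i)
      dropped-≈ i j same = trans (proj₂ (cover j)) (trans (reflexive (≡.cong r (≡.sym same))) (sym (proj₂ (cover i))))

  -- Separated families of subgroups

  record SeparatedFamily (J : Set) (L K : Subset) : Set (Level.suc (c ⊔ ℓ)) where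
    field
      H           : J → Subset
      e           : J → Carrier
      W           : Subset
      W⊆K         : W ⊆ K
      H⊆W         : ∀ j → H j ⊆ W
      W-subgroup  : IsAddSubgroup W
      W-definable : Definable W
      H-subgroup  : ∀ j → IsAddSubgroup (H j)
      H-definable : ∀ j → Definable (H j)
      *e∈W        : ∀ {l} → L l → ∀ j → W (l * e j)
      *e∈H        : ∀ {l} → L l → ∀ {j j'} → j ≢ j' → H j' (l * e j)
      *e∈H⇒≈0     : ∀ {l} → L l → ∀ j → H j (l * e j) → l ≈ 0#

  reindex : ∀ {J J' L K} → J' ↣ J → SeparatedFamily J L K → SeparatedFamily J' L K
  reindex σ S = record
    { H = H ∘ ι ; e = e ∘ ι ; W = W ; W⊆K = W⊆K ; H⊆W = H⊆W ∘ ι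
    ; W-subgroup = W-subgroup ; W-definable = W-definable
    ; H-subgroup = H-subgroup ∘ ι ; H-definable = H-definable ∘ ι
    ; *e∈W = λ Ll j → *e∈W Ll (ι j)
    ; *e∈H = λ Ll j≢j' → *e∈H Ll (j≢j' ∘ injective)
    ; *e∈H⇒≈0 = λ Ll j → *e∈H⇒≈0 Ll (ι j)
    }
    where open SeparatedFamily S
          open Injection σ renaming (to to ι)

  singleton : ∀ {L} → IsSubfield L → Definable L → SeparatedFamily (Fin 1) L L
  singleton {L} sL dL = record
    { H = λ _ → ｛0｝ ; e = λ _ → 1# ; W = L ; W⊆K = λ _ → id
    ; H⊆W = λ _ x (lift x≈0) → resp (sym x≈0) 0∈
    ; W-subgroup = IsSubfield⇒IsAddSubgroup sL ; W-definable = dL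
    ; H-subgroup = λ _ → IsAddSubgroup-｛0｝ ; H-definable = λ _ → Definable-｛0｝
    ; *e∈W = λ Ll _ → resp (sym (*-identityʳ _)) Ll
    ; *e∈H = λ { _ {fzero} {fzero} 0≢0 → ⊥-elim (0≢0 ≡.refl) }
    ; *e∈H⇒≈0 = λ _ _ (lift l1≈0) → trans (sym (*-identityʳ _)) l1≈0
    }
    where open IsSubfield sL

  module _ (lem : ∀ {p} → ExcludedMiddle p) where

    ε-choice : ∀ {a p} {A : Set a} (P : A → Set p) → A → Σ A λ x → Σ A P → P x
    ε-choice P default with lem {P = Σ _ P}
    ... | yes (x , Px) = x , λ _ → Px
    ... | no ¬∃P = default , λ ∃P → ⊥-elim (¬∃P ∃P)

    ¬⊆⇒∃∉ : ∀ {a} {I : Set a} {P} (F : I → Subset) → ¬ (∀ i → P ⊆ F i) → Σ I λ i → Σ Carrier λ x → P x × ¬ F i x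
    ¬⊆⇒∃∉ {P = P} F P⊈F with lem {P = Σ _ λ i → Σ Carrier λ x → P x × ¬ F i x}
    ... | yes found = found
    ... | no none = ⊥-elim (P⊈F λ i x Px → decidable-stable lem λ ¬Fix → none (i , x , Px , ¬Fix))

    x*b∈K⇒x≈0 : ∀ {K b x} → IsSubfield K → ¬ K b → K x → K (x * b) → x ≈ 0#
    x*b∈K⇒x≈0 sK b∉K Kx Kxb = decidable-stable lem λ x≉0 →
      let (y , Ky , xy≈1) = inv-closed Kx x≉0 in
      b∉K (resp (y*[x*b]≈b _ (trans (comm Ky Kx) xy≈1)) (*-closed Ky Kxb))
      where open IsSubfield sK

    coefficients-unique : ∀ {K b x y x' y'} → IsSubfield K → ¬ K b → K x → K y → K x' → K y' →
                          x + y * b ≈ x' + y' * b → x ≈ x' × y ≈ y'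
    coefficients-unique {K} {b} {x} {y} {x'} {y'} sK b∉K Kx Ky Kx' Ky' eq = x≈x' , y≈y'
      where
      [y-y']b≈x'-x : (y - y') * b ≈ x' - x
      [y-y']b≈x'-x = begin
        (y - y') * b                    ≈⟨ [y-z]x≈yx-zx b y y' ⟩
        y * b - y' * b                  ≈⟨ +-congʳ (\\-leftDividesʳ x (y * b)) ⟨
        (- x + (x + y * b)) - y' * b    ≈⟨ +-congʳ (+-congˡ eq) ⟩
        (- x + (x' + y' * b)) - y' * b  ≈⟨ +-congʳ (+-assoc (- x) x' (y' * b)) ⟨
        ((- x + x') + y' * b) - y' * b  ≈⟨ //-rightDividesʳ (y' * b) (- x + x') ⟩
        - x + x'                        ≈⟨ +-comm (- x) x' ⟩
        x' - x                          ∎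
      K-subgroup : IsAddSubgroup K
      K-subgroup = IsSubfield⇒IsAddSubgroup sK
      y≈y' : y ≈ y'
      y≈y' = x∙y⁻¹≈ε⇒x≈y y y' (x*b∈K⇒x≈0 sK b∉K (-‿closed K-subgroup Ky Ky')
               (IsSubfield.resp sK (sym [y-y']b≈x'-x) (-‿closed K-subgroup Kx' Kx)))
      x≈x' : x ≈ x'
      x≈x' = +-cancelʳ (y * b) x x' (trans eq (+-congˡ (*-congʳ (sym y≈y'))))

    module Doubling {J L K K'} (sK : IsSubfield K) (sK' : IsSubfield K') (K'⊂K : K' ⊂ K)
                    (S : SeparatedFamily J L K') where
      module S = SeparatedFamily S

      b : Carrier
      b = proj₁ (proj₂ K'⊂K)

      b∉K' : ¬ K' b
      b∉K' = proj₂ (proj₂ (proj₂ K'⊂K))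

      W'⊆K' : ∀ {x} → S.W x → K' x
      W'⊆K' = S.W⊆K _

      W'⊆K : S.W ⊆ K
      W'⊆K x = proj₁ K'⊂K x ∘ W'⊆K'

      H : Fin 2 × J → Subset
      H (fzero , j) = S.H j ⊞ S.W · b
      H (fsuc fzero , j) = S.W ⊞ S.H j · b

      e : Fin 2 × J → Carrier
      e (fzero , j) = S.e j
      e (fsuc fzero , j) = S.e j * b

      H⊆W : ∀ i → H i ⊆ (S.W ⊞ S.W · b)
      H⊆W (fzero , j) = ⊞-mono b (S.H⊆W j) (λ _ → id)
      H⊆W (fsuc fzero , j) = ⊞-mono b (λ _ → id) (S.H⊆W j)

      H-subgroup : ∀ i → IsAddSubgroup (H i)
      H-subgroup (fzero , j) = IsAddSubgroup-⊞ (S.H-subgroup j) S.W-subgroup b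
      H-subgroup (fsuc fzero , j) = IsAddSubgroup-⊞ S.W-subgroup (S.H-subgroup j) b

      H-definable : ∀ i → Definable (H i)
      H-definable (fzero , j) = Definable-⊞ (S.H-definable j) S.W-definable b
      H-definable (fsuc fzero , j) = Definable-⊞ S.W-definable (S.H-definable j) b

      *e∈W : ∀ {l} → L l → ∀ i → (S.W ⊞ S.W · b) (l * e i)
      *e∈W Ll (fzero , j) = ⊞-introˡ b S.W-subgroup _ (S.*e∈W Ll j)
      *e∈W Ll (fsuc fzero , j) = ⊞-intro-* b S.W-subgroup S.W-subgroup (S.*e∈W Ll j)

      *e∈H : ∀ {l} → L l → ∀ {i i'} → i ≢ i' → H i' (l * e i)
      *e∈H Ll {fzero , j} {fzero , j'} i≢i' = ⊞-introˡ b S.W-subgroup _ (S.*e∈H Ll (i≢i' ∘ ≡.cong (fzero ,_)))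
      *e∈H Ll {fzero , j} {fsuc fzero , j'} _ = ⊞-introˡ b (S.H-subgroup j') _ (S.*e∈W Ll j)
      *e∈H Ll {fsuc fzero , j} {fzero , j'} _ = ⊞-intro-* b (S.H-subgroup j') S.W-subgroup (S.*e∈W Ll j)
      *e∈H Ll {fsuc fzero , j} {fsuc fzero , j'} i≢i' =
        ⊞-intro-* b S.W-subgroup (S.H-subgroup j') (S.*e∈H Ll (i≢i' ∘ ≡.cong (fsuc fzero ,_)))

      *e∈H⇒≈0 : ∀ {l} → L l → ∀ i → H i (l * e i) → l ≈ 0#
      *e∈H⇒≈0 {l} Ll (fzero , j) (y , z , Hy , Wz , le≈y+zb) =
        S.*e∈H⇒≈0 Ll j (IsAddSubgroup.resp (S.H-subgroup j) (sym le≈y) Hy)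
        where
        le≈y : l * S.e j ≈ y
        le≈y = proj₁ (coefficients-unique sK' b∉K' (W'⊆K' (S.*e∈W Ll j)) (IsSubfield.0∈ sK')
                        (W'⊆K' (S.H⊆W j y Hy)) (W'⊆K' Wz) (trans (sym (x≈x+0*b _ b)) le≈y+zb))
      *e∈H⇒≈0 {l} Ll (fsuc fzero , j) (y , z , Wy , Hz , leb≈y+zb) =
        S.*e∈H⇒≈0 Ll j (IsAddSubgroup.resp (S.H-subgroup j) (sym le≈z) Hz)
        where
        le≈z : l * S.e j ≈ z
        le≈z = proj₂ (coefficients-unique sK' b∉K' (IsSubfield.0∈ sK') (W'⊆K' (S.*e∈W Ll j))
                        (W'⊆K' Wy) (W'⊆K' (S.H⊆W j z Hz))
                        (trans (+-identityˡ _) (trans (*-assoc l (S.e j) b) leb≈y+zb)))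

      double : SeparatedFamily (Fin 2 × J) L K
      double = record
        { H = H ; e = e ; W = S.W ⊞ S.W · b
        ; W⊆K = ⊞-⊆ sK (proj₁ (proj₂ (proj₂ K'⊂K))) W'⊆K W'⊆K
        ; H⊆W = H⊆W
        ; W-subgroup = IsAddSubgroup-⊞ S.W-subgroup S.W-subgroup b
        ; W-definable = Definable-⊞ S.W-definable S.W-definable b
        ; H-subgroup = H-subgroup ; H-definable = H-definable
        ; *e∈W = *e∈W ; *e∈H = *e∈H ; *e∈H⇒≈0 = *e∈H⇒≈0
        }

    open Doubling using (double)

    chain⇒separated : ∀ k (F : Fin (suc k) → Subset) → (∀ i → IsSubfield (F i)) → Definable (F (fromℕ k)) →
                      StrictlyDescending F → SeparatedFamily (Fin (2 ^ k)) (F (fromℕ k)) (F fzero)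
    chain⇒separated zero F sF dL sd = singleton (sF fzero) dL
    chain⇒separated (suc k) F sF dL sd =
      -- Fin (2 ^ suc k) is Fin (2 * 2 ^ k) by definition
      reindex (↔⇒↣ *↔×) (double (sF fzero) (sF (fsuc fzero)) (sd fzero (fsuc fzero) (s≤s z≤n))
        (chain⇒separated k (F ∘ fsuc) (sF ∘ fsuc) dL λ i j i<j → sd (fsuc i) (fsuc j) (s≤s i<j)))

    -- Consequences of (†)ₙ

    separated⇒finite : ∀ {n L K} → Dagger n → IsAddSubgroup L → SeparatedFamily (Fin (suc n)) L K → FiniteSubset L
    separated⇒finite {n} {L} dagger sL S = finite (dagger H H-definable H-subgroup)
      where
      open SeparatedFamily S
      finite : Σ (Fin (suc n)) (λ j → FiniteIndexIn (⋂ H) (⋂-without H j)) → FiniteSubset L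
      finite (j , k , r , _ , coset) = k , proj₁ ∘ representative , covers
        where
        InCoset : Fin k → Subset
        InCoset t x = L x × H j (x * e j - r t)
        representative : ∀ t → Σ Carrier λ x → Σ Carrier (InCoset t) → InCoset t x
        representative t = ε-choice (InCoset t) 0#
        covers : ∀ l → L l → Σ (Fin k) λ t → l ≈ proj₁ (representative t)
        covers l Ll with coset (l * e j) (λ i i≢j → *e∈H Ll (i≢j ∘ ≡.sym))
        ... | t , l∈coset with proj₂ (representative t) (l , Ll , l∈coset j)
        ...   | Lc , c∈coset = t , x∙y⁻¹≈ε⇒x≈y _ _ (*e∈H⇒≈0 (-‿closed sL Ll Lc) j
                  (IsAddSubgroup.resp (H-subgroup j) (sym ([y-z]x≈yx-zx (e j) _ _))
                    (same-coset⇒-‿∈ (H-subgroup j) (l∈coset j) c∈coset)))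

    descending-chain-bound : ∀ {n k} → Dagger n → (F : Fin (suc k) → Subset) → (∀ i → IsSubfield (F i)) →
                             Definable (F (fromℕ k)) → InfiniteSubset (F (fromℕ k)) → StrictlyDescending F →
                             2 ^ k ≤ n
    descending-chain-bound {k = k} dagger F sF dL L-infinite sd = ≮⇒≥ λ n<2^k →
      L-infinite (separated⇒finite dagger (IsSubfield⇒IsAddSubgroup (sF (fromℕ k)))
        (reindex (mk↣ {to = λ i → inject≤ i n<2^k} λ {i} {j} → inject≤-injective n<2^k n<2^k i j)
          (chain⇒separated k F sF dL sd)))

    chain-length-bound : ∀ {n} → Dagger n → (m : ℕ) (F : Fin m → Subset) →
                         (∀ i → Definable (F i)) → (∀ i → IsSubfield (F i)) → (∀ i → InfiniteSubset (F i)) →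
                         StrictlyDescending F → m ≤ ⌊log₂ n ⌋ ℕ.+ 1
    chain-length-bound dagger zero _ _ _ _ _ = z≤n
    chain-length-bound {n} dagger (suc k) F dF sF iF sd =
      ≡.subst (_≤ ⌊log₂ n ⌋ ℕ.+ 1) (ℕₚ.+-comm k 1) (ℕₚ.+-monoˡ-≤ 1 (2^k≤n⇒k≤⌊log₂n⌋
        (descending-chain-bound dagger F sF (dF (fromℕ k)) (iF (fromℕ k)) sd)))

    finite-subfamily : ∀ {a n} {I : Set a} → Dagger n → (F : I → Subset) →
                       (∀ i → Definable (F i)) → (∀ i → IsSubfield (F i)) →
                       Σ ℕ λ k → Σ (Fin k → I) λ idx → ∀ i → ⋂ (F ∘ idx) ⊆ F i
    finite-subfamily {n = n} {I} dagger F dF sF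
      with lem {P = Σ ℕ λ k → Σ (Fin k → I) λ idx → ∀ i → ⋂ (F ∘ idx) ⊆ F i}
    ... | yes found = found
    ... | no none = ⊥-elim (n≮n N (chain-length-bound dagger (suc N) (C ∘ suc ∘ toℕ)
                      (λ t → Definable-⋂ _ (dF ∘ chosen (suc (toℕ t))))
                      (λ t → IsSubfield-⋂ _ (sF ∘ chosen (suc (toℕ t))))
                      (λ t → C-infinite (suc (toℕ t)))
                      (⊂-sequence⇒StrictlyDescending {S = C ∘ suc} (C-⊂ ∘ suc))))
      where
      N : ℕ
      N = ⌊log₂ n ⌋ ℕ.+ 1
      escape : ∀ {k} (idx : Fin k → I) → Σ I λ i → Σ Carrier λ x → ⋂ (F ∘ idx) x × ¬ F i x
      escape idx = ¬⊆⇒∃∉ F λ ⋂⊆F → none (_ , idx , ⋂⊆F)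
      chosen : (q : ℕ) → Fin q → I
      chosen zero = λ ()
      chosen (suc q) = proj₁ (escape (chosen q)) ∷ₐ chosen q
      C : ℕ → Subset
      C q = ⋂ (F ∘ chosen q)
      C-⊂ : ∀ q → C (suc q) ⊂ C q
      C-⊂ q with escape (chosen q)
      ... | _ , x , Cx , x∉F = (λ _ h → h ∘ fsuc) , x , Cx , λ h → x∉F (h fzero)
      C-infinite : ∀ p → InfiniteSubset (C p)
      C-infinite p = ⊂-sequence⇒infinite (λ q → C-⊂ (q ℕ.+ p)) λ q x≈y h i → IsSubfield.resp (sF _) x≈y (h i)

open Semantics
open import Data.Nat using (_+_)

corollary4p6 : (lem : ∀ {p} → ExcludedMiddle p) →
    ∀ {c ℓ a : Level} (D : DivisionRing c ℓ) →
    (n : ℕ) → 1 ≤ n → Infinite D → Dagger D n →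
    ((m : ℕ) (F : Fin m → Subset D) →
       (∀ i → Definable D (F i)) → (∀ i → IsSubfield D (F i)) →
       (∀ i → InfiniteSubset D (F i)) →
       StrictlyDescending D F → m ≤ ⌊log₂ n ⌋ + 1)
    ×
    ((I : Set a) (F : I → Subset D) →
       (∀ i → Definable D (F i)) → (∀ i → IsSubfield D (F i)) →
       Σ ℕ λ k → Σ (Fin k → I) λ idx →
         (∀ x → (∀ i → F i x) ⇔ (∀ t → F (idx t) x)) ×
         Definable D (λ x → ∀ t → F (idx t) x))
corollary4p6 lem D n _ _ dagger =
    chain-length-bound D lem dagger
  , λ I F dF sF → let (k , idx , ⋂idx⊆F) = finite-subfamily D lem dagger F dF sF in
      k , idx , (λ x → mk⇔ (λ h t → h (idx t)) (λ h i → ⋂idx⊆F i x h)) , Definable-⋂ D (F ∘ idx) (dF ∘ idx)
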